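{- Let $A,B$ be finite alphabets, let $h,g\colon A^*\to B^*$ be morphisms and let $w\in A^*$. Then $h(w)$ and $g(w)$ are conjugates if and only if $h(w_1)$ and $g(w_2)$ are conjugates for all conjugates $w_1$ and $w_2$ of $w$.
   Context: Two words $x$ and $y$ are conjugates if there exist words $u$ and $v$ such that $x=uv$ and $y=vu$. -}

module Defs where

open import Data.List using (List; _++_)
open import Data.Product using (∃-syntax; _×_)
open import Relation.Binary.PropositionalEquality using (_≡_)

Conjugate : ∀ {A : Set} → List A → List A → Set
Conjugate {A} x y = ∃[ u ] ∃[ v ] (x ≡ u ++ v × y ≡ v ++ u)

IsMorphism : ∀ {A B : Set} → (List A → List B) → Set
IsMorphism h = ∀ u v → h (u ++ v) ≡ h u ++ h v

{-# OPTIONS --safe #-}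
module Submission where

open import Defs
open import Data.Nat using (ℕ)
open import Data.Fin using (Fin)
open import Data.List using (List; []; _∷_; _++_)
open import Data.List.Properties using (++-assoc; ++-identityʳ; ∷-injective)
open import Data.Product using (∃-syntax; _×_; _,_)
open import Data.Sum using (_⊎_; inj₁; inj₂)
open import Function.Bundles using (_⇔_; mk⇔)
open import Relation.Binary.PropositionalEquality
  using (_≡_; refl; sym; trans; cong; module ≡-Reasoning)

-- Conjugacy is an equivalence relation preserved by morphisms, so
-- h(w₁) ~ h(w) ~ g(w) ~ g(w₂); conversely take w₁ = w₂ = w. Transitivity
-- rests on Levi's lemma (equidivisibility of free monoids).

module _ {A : Set} where

  ++-equidivisible : (a b c d : List A) → a ++ b ≡ c ++ d →
                     (∃[ s ] (c ≡ a ++ s × b ≡ s ++ d)) ⊎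
                     (∃[ s ] (a ≡ c ++ s × d ≡ s ++ b))
  ++-equidivisible []      b c       d eq = inj₁ (c , refl , eq)
  ++-equidivisible (x ∷ a) b []      d eq = inj₂ (x ∷ a , refl , sym eq)
  ++-equidivisible (x ∷ a) b (y ∷ c) d eq with ∷-injective eq
  ... | refl , eq′ with ++-equidivisible a b c d eq′
  ...   | inj₁ (s , c≡as , b≡sd) = inj₁ (s , cong (x ∷_) c≡as , b≡sd)
  ...   | inj₂ (s , a≡cs , d≡sb) = inj₂ (s , cong (x ∷_) a≡cs , d≡sb)

  Conjugate-refl : (x : List A) → Conjugate x x
  Conjugate-refl x = x , [] , sym (++-identityʳ x) , refl

  Conjugate-sym : {x y : List A} → Conjugate x y → Conjugate y x
  Conjugate-sym (u , v , x≡uv , y≡vu) = v , u , y≡vu , x≡uv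

  Conjugate-trans : {x y z : List A} → Conjugate x y → Conjugate y z → Conjugate x z
  Conjugate-trans {x} {y} {z} (u , v , x≡uv , y≡vu) (p , q , y≡pq , z≡qp)
    with ++-equidivisible v u p q (trans (sym y≡vu) y≡pq)
  ... | inj₁ (s , p≡vs , u≡sq) = s , q ++ v , x≡s[qv] , z≡[qv]s
    where
    open ≡-Reasoning
    x≡s[qv] : x ≡ s ++ (q ++ v)
    x≡s[qv] = begin
      x             ≡⟨ x≡uv ⟩
      u ++ v        ≡⟨ cong (_++ v) u≡sq ⟩
      (s ++ q) ++ v ≡⟨ ++-assoc s q v ⟩
      s ++ (q ++ v) ∎
    z≡[qv]s : z ≡ (q ++ v) ++ s
    z≡[qv]s = begin
      z             ≡⟨ z≡qp ⟩
      q ++ p        ≡⟨ cong (q ++_) p≡vs ⟩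
      q ++ (v ++ s) ≡⟨ ++-assoc q v s ⟨
      (q ++ v) ++ s ∎
  ... | inj₂ (s , v≡ps , q≡su) = u ++ p , s , x≡[up]s , z≡s[up]
    where
    open ≡-Reasoning
    x≡[up]s : x ≡ (u ++ p) ++ s
    x≡[up]s = begin
      x             ≡⟨ x≡uv ⟩
      u ++ v        ≡⟨ cong (u ++_) v≡ps ⟩
      u ++ (p ++ s) ≡⟨ ++-assoc u p s ⟨
      (u ++ p) ++ s ∎
    z≡s[up] : z ≡ s ++ (u ++ p)
    z≡s[up] = begin
      z             ≡⟨ z≡qp ⟩
      q ++ p        ≡⟨ cong (_++ p) q≡su ⟩
      (s ++ u) ++ p ≡⟨ ++-assoc s u p ⟩
      s ++ (u ++ p) ∎

Conjugate-morphism : ∀ {A B : Set} {h : List A → List B} → IsMorphism h →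
                     {x y : List A} → Conjugate x y → Conjugate (h x) (h y)
Conjugate-morphism {h = h} h-morphism (u , v , refl , refl) =
  h u , h v , h-morphism u v , h-morphism v u

lemma3 : (a b : ℕ) (h g : List (Fin a) → List (Fin b)) →
         IsMorphism h → IsMorphism g → (w : List (Fin a)) →
         Conjugate (h w) (g w) ⇔
           (∀ (w₁ w₂ : List (Fin a)) → Conjugate w w₁ → Conjugate w w₂ →
             Conjugate (h w₁) (g w₂))
lemma3 a b h g h-morphism g-morphism w = mk⇔ to from
  where
  to : Conjugate (h w) (g w) → ∀ w₁ w₂ → Conjugate w w₁ → Conjugate w w₂ →
       Conjugate (h w₁) (g w₂)
  to hw~gw w₁ w₂ w~w₁ w~w₂ =
    Conjugate-trans (Conjugate-sym (Conjugate-morphism h-morphism w~w₁))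
      (Conjugate-trans hw~gw (Conjugate-morphism g-morphism w~w₂))

  from : (∀ w₁ w₂ → Conjugate w w₁ → Conjugate w w₂ → Conjugate (h w₁) (g w₂)) →
         Conjugate (h w) (g w)
  from all-conjugate = all-conjugate w w (Conjugate-refl w) (Conjugate-refl w)
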